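{- If a finite poset $P$ has a U-labeling, then it also has an injective U-labeling.
   Context: Let $E=\{(x,y): x\lessdot y\}$ be the set of covering pairs (edges of the Hasse diagram) of $P$, where $x\lessdot y$ means $x<y$ with nothing strictly between. An edge labeling is a map $\lambda:E\to\mathbb{Z}$. An unrefinable chain from $x$ to $y$ is a sequence $x=x_0\lessdot x_1\lessdot\cdots\lessdot x_m=y$; it is rising if $\lambda(x_0,x_1)\le\lambda(x_1,x_2)\le\cdots\le\lambda(x_{m-1},x_m)$. A labeling $\lambda$ is a U-labeling if for every pair $x\le y$ in $P$ there is exactly one rising unrefinable chain from $x$ to $y$. -}

module Defs where

open import Level using (0ℓ)
open import Data.Nat using (ℕ)
open import Data.Fin using (Fin)
open import Data.Integer using (ℤ) renaming (_≤_ to _≤ℤ_)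
open import Data.List using (List; []; _∷_)
open import Data.List.Relation.Unary.Linked using (Linked)
open import Data.Product using (_×_; ∃; ∃!)
open import Relation.Nullary using (¬_)
open import Relation.Binary using (Rel; IsDecPartialOrder)
open import Relation.Binary.PropositionalEquality using (_≡_)

module _ {n : ℕ} (_≼_ : Rel (Fin n) 0ℓ) where

  _≺_ : Rel (Fin n) 0ℓ
  x ≺ y = (x ≼ y) × ¬ (x ≡ y)

  _⋖_ : Rel (Fin n) 0ℓ
  x ⋖ y = (x ≺ y) × (∀ z → ¬ ((x ≺ z) × (z ≺ y)))

  -- An edge labeling: only its values on covering pairs are relevant.
  EdgeLabeling : Set
  EdgeLabeling = Fin n → Fin n → ℤ

  -- A chain from x is given by the list of vertices x₁, …, xₘ following x = x₀.
  -- EndsAt x zs y : the last vertex of x ∷ zs is y.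
  EndsAt : Fin n → List (Fin n) → Fin n → Set
  EndsAt x []       y = x ≡ y
  EndsAt x (z ∷ zs) y = EndsAt z zs y

  UnrefinableChain : Fin n → Fin n → List (Fin n) → Set
  UnrefinableChain x y zs = Linked _⋖_ (x ∷ zs) × EndsAt x zs y

  labels : EdgeLabeling → Fin n → List (Fin n) → List ℤ
  labels λ' x []       = []
  labels λ' x (z ∷ zs) = λ' x z ∷ labels λ' z zs

  RisingChain : EdgeLabeling → Fin n → Fin n → List (Fin n) → Set
  RisingChain λ' x y zs = UnrefinableChain x y zs × Linked _≤ℤ_ (labels λ' x zs)

  IsULabeling : EdgeLabeling → Set
  IsULabeling λ' = ∀ x y → x ≼ y → ∃! _≡_ (RisingChain λ' x y)

  IsInjectiveOnEdges : EdgeLabeling → Set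
  IsInjectiveOnEdges λ' = ∀ {x y x' y'} → x ⋖ y → x' ⋖ y' →
                          λ' x y ≡ λ' x' y' → (x ≡ x') × (y ≡ y')

module Submission where

open import Defs
open import Level using (0ℓ)
open import Data.Nat using (ℕ)
open import Data.Fin using (Fin)
open import Data.Product using (_×_; ∃)
open import Relation.Binary using (Rel; IsDecPartialOrder)
open import Relation.Binary.PropositionalEquality using (_≡_)

open import Data.Nat using (suc; s≤s) renaming (_*_ to _*ℕ_)
import Data.Nat.Properties as ℕ
open import Data.Fin using (toℕ; fromℕ<; combine) renaming (_<_ to _<ᶠ_; _≤_ to _≤ᶠ_)
open import Data.Fin.Properties
  using (toℕ<n; toℕ-injective; toℕ-fromℕ<; combine-monoˡ-<; combine-injectiveˡ; combine-injectiveʳ)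
open import Data.Fin.Subset using (Subset; _∈_; _⊂_)
open import Data.Fin.Subset.Properties using (∣p∣≤n; p⊂q⇒∣p∣<∣q∣)
open import Data.Integer using (ℤ; +_; _+_; _*_; _≤_; _<_; +≤+; +<+) renaming (suc to sucℤ)
import Data.Integer.Properties as ℤ
open import Algebra.Bundles using (AbelianGroup)
open import Algebra.Properties.Group (AbelianGroup.group ℤ.+-0-abelianGroup) using (∙-cancelˡ)
open import Data.List using ([]; _∷_)
open import Data.List.Relation.Unary.Linked using (Linked; []; [-]; _∷_)
open import Data.Vec using (tabulate)
open import Data.Vec.Properties using (lookup∘tabulate; []=⇒lookup; lookup⇒[]=)
open import Data.Product using (_,_; proj₁; proj₂)
open import Relation.Nullary using (yes; no; does)
open import Relation.Nullary.Decidable using (dec-true)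
open import Relation.Binary.PropositionalEquality using (refl; sym; trans; cong)

-- Idea: refine σ
-- lexicographically by a tie-breaking code, μ(x,y) = K·σ(x,y) + ι(x,y),
-- where ι injectively encodes the edge (x,y) by a number below K and
-- increases along consecutive covering edges.  Then
--   * μ is injective, because the pair (σ(x,y), ι(x,y)) can be read off μ(x,y);
--   * for consecutive edges x ⋖ z ⋖ w, σ(x,z) ≤ σ(z,w) ⇔ μ(x,z) ≤ μ(z,w),
--     so σ and μ have exactly the same rising chains, and μ is a U-labeling.

module Lexicographic (K : ℕ) where

  lex : ℤ → Fin K → ℤ
  lex a i = + K * a + + toℕ i

  lex-mono : ∀ {a b i j} → a ≤ b → i ≤ᶠ j → lex a i ≤ lex b j
  lex-mono a≤b i≤j = ℤ.+-mono-≤ (ℤ.*-monoˡ-≤-nonNeg (+ K) a≤b) (+≤+ i≤j)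

  lex-dominates : ∀ {a b} (i j : Fin K) → b < a → lex b j < lex a i
  lex-dominates {a} {b} i j b<a = begin-strict
    + K * b + + toℕ j   <⟨ ℤ.+-monoʳ-< (+ K * b) (+<+ (toℕ<n j)) ⟩
    + K * b + + K       ≡⟨ ℤ.+-comm (+ K * b) (+ K) ⟩
    + K + + K * b       ≡⟨ ℤ.*-suc (+ K) b ⟨
    + K * sucℤ b        ≤⟨ ℤ.*-monoˡ-≤-nonNeg (+ K) (ℤ.i<j⇒suc[i]≤j b<a) ⟩
    + K * a             ≤⟨ ℤ.i≤i+j (+ K * a) (+ toℕ i) ⟩
    + K * a + + toℕ i   ∎
    where open ℤ.≤-Reasoning

  lex-reflects-≤ : ∀ {a b i j} → lex a i ≤ lex b j → a ≤ b
  lex-reflects-≤ {i = i} {j} le = ℤ.≮⇒≥ (λ b<a → ℤ.<⇒≱ (lex-dominates i j b<a) le)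

  lex-injective : ∀ {a b i j} → lex a i ≡ lex b j → a ≡ b × i ≡ j
  lex-injective {a} {b} {i} {j} eq = a≡b , i≡j
    where
    a≡b : a ≡ b
    a≡b = ℤ.≤-antisym (lex-reflects-≤ (ℤ.≤-reflexive eq)) (lex-reflects-≤ (ℤ.≤-reflexive (sym eq)))
    i≡j : i ≡ j
    i≡j = toℕ-injective (ℤ.+-injective
            (∙-cancelˡ (+ K * b) (+ toℕ i) (+ toℕ j) (trans (cong (λ c → + K * c + + toℕ i) (sym a≡b)) eq)))

-- Whether a chain is rising only depends on which pairs of consecutive
-- covering edges are rising steps; so labelings agreeing on those steps have
-- the same rising chains.
module RisingTransfer {n : ℕ} (_≼_ : Rel (Fin n) 0ℓ) where

  PreservesRises : EdgeLabeling _≼_ → EdgeLabeling _≼_ → Set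
  PreservesRises σ τ = ∀ {x z w} → _⋖_ _≼_ x z → σ x z ≤ σ z w → τ x z ≤ τ z w

  rising-labels : ∀ {σ τ} → PreservesRises σ τ → ∀ x zs → Linked (_⋖_ _≼_) (x ∷ zs) →
                  Linked _≤_ (labels _≼_ σ x zs) → Linked _≤_ (labels _≼_ τ x zs)
  rising-labels keep x []           _              _           = []
  rising-labels keep x (z ∷ [])     _              _           = [-]
  rising-labels keep x (z ∷ w ∷ zs) (x⋖z ∷ covers) (r ∷ rises) =
    keep x⋖z r ∷ rising-labels keep z (w ∷ zs) covers rises

  rising-chain : ∀ {σ τ} → PreservesRises σ τ → ∀ {x y zs} →
                 RisingChain _≼_ σ x y zs → RisingChain _≼_ τ x y zs
  rising-chain keep {x} {zs = zs} (chain , rises) = chain , rising-labels keep x zs (proj₁ chain) rises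

  U-labeling-transfer : ∀ {σ τ} → PreservesRises σ τ → PreservesRises τ σ →
                        IsULabeling _≼_ σ → IsULabeling _≼_ τ
  U-labeling-transfer keep reflect U x y x≼y with U x y x≼y
  ... | zs , rising , unique = zs , rising-chain keep rising , λ other → unique (rising-chain reflect other)

-- An injective code of the pairs of elements which increases along the order:
-- rank x = (size of the down-set of x, x) is a linear extension of ≼, and the
-- code of (x , y) is (rank x , y), both read in mixed radix via combine.
module EdgeCode {n : ℕ} {_≼_ : Rel (Fin n) 0ℓ} (po : IsDecPartialOrder _≡_ _≼_) where
  open IsDecPartialOrder po using (_≤?_) renaming (reflexive to ≼-reflexive; trans to ≼-trans; antisym to ≼-antisym)

  downset : Fin n → Subset n
  downset x = tabulate (λ z → does (z ≤? x))

  ∈-downset⁺ : ∀ {z x} → z ≼ x → z ∈ downset x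
  ∈-downset⁺ {z} {x} z≼x =
    lookup⇒[]= z (downset x) (trans (lookup∘tabulate _ z) (dec-true (z ≤? x) z≼x))

  ∈-downset⁻ : ∀ {z x} → z ∈ downset x → z ≼ x
  ∈-downset⁻ {z} {x} z∈↓x with z ≤? x | trans (sym (lookup∘tabulate _ z)) ([]=⇒lookup z∈↓x)
  ... | yes z≼x | _ = z≼x
  ... | no _    | ()

  -- x ≺ y makes the down-set of x a proper subset of that of y (y itself is missing)
  downset-⊂ : ∀ {x y} → _≺_ _≼_ x y → downset x ⊂ downset y
  downset-⊂ {x} {y} (x≼y , x≢y) =
    (λ z∈↓x → ∈-downset⁺ (≼-trans (∈-downset⁻ z∈↓x) x≼y)) ,
    y , ∈-downset⁺ (≼-reflexive refl) , λ y∈↓x → x≢y (≼-antisym x≼y (∈-downset⁻ y∈↓x))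

  height : Fin n → Fin (suc n)
  height x = fromℕ< (s≤s (∣p∣≤n (downset x)))

  height-strict : ∀ {x y} → _≺_ _≼_ x y → height x <ᶠ height y
  height-strict {x} {y} x≺y
    rewrite toℕ-fromℕ< (s≤s (∣p∣≤n (downset x))) | toℕ-fromℕ< (s≤s (∣p∣≤n (downset y))) =
    p⊂q⇒∣p∣<∣q∣ (downset-⊂ x≺y)

  rank : Fin n → Fin (suc n *ℕ n)
  rank x = combine (height x) x

  rank-strict : ∀ {x y} → _≺_ _≼_ x y → rank x <ᶠ rank y
  rank-strict {x} {y} x≺y = combine-monoˡ-< x y (height-strict x≺y)

  rank-injective : ∀ {x y} → rank x ≡ rank y → x ≡ y
  rank-injective {x} {y} = combine-injectiveʳ (height x) x (height y) y

  edgeCode : Fin n → Fin n → Fin (suc n *ℕ n *ℕ n)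
  edgeCode x y = combine (rank x) y

  edgeCode-strict : ∀ {x y z w} → _≺_ _≼_ x z → edgeCode x y <ᶠ edgeCode z w
  edgeCode-strict {y = y} {w = w} x≺z = combine-monoˡ-< y w (rank-strict x≺z)

  edgeCode-injective : ∀ {x y x' y'} → edgeCode x y ≡ edgeCode x' y' → x ≡ x' × y ≡ y'
  edgeCode-injective {x} {y} {x'} {y'} eq =
    rank-injective (combine-injectiveˡ (rank x) y (rank x') y' eq) ,
    combine-injectiveʳ (rank x) y (rank x') y' eq

module TieBreaking {n K : ℕ} (_≼_ : Rel (Fin n) 0ℓ) (code : Fin n → Fin n → Fin K)
  (code-injective : ∀ {x y x' y'} → code x y ≡ code x' y' → x ≡ x' × y ≡ y')
  (code-mono : ∀ {x z w} → _⋖_ _≼_ x z → code x z ≤ᶠ code z w) where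
  open Lexicographic K
  open RisingTransfer _≼_

  refine : EdgeLabeling _≼_ → EdgeLabeling _≼_
  refine σ x y = lex (σ x y) (code x y)

  -- rises of σ stay rises since the code does not decrease along covers;
  -- rises of the refinement are rises of σ since the code is only a lower digit
  refine-U : ∀ {σ} → IsULabeling _≼_ σ → IsULabeling _≼_ (refine σ)
  refine-U = U-labeling-transfer (λ x⋖z rise → lex-mono rise (code-mono x⋖z))
                                 (λ _ rise → lex-reflects-≤ rise)

  refine-injective : ∀ σ → IsInjectiveOnEdges _≼_ (refine σ)
  refine-injective σ _ _ eq = code-injective (proj₂ (lex-injective eq))

proposition2 : (n : ℕ) (_≼_ : Rel (Fin n) 0ℓ) → IsDecPartialOrder _≡_ _≼_ →
    ∃ (λ λ' → IsULabeling _≼_ λ') →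
    ∃ (λ μ → IsULabeling _≼_ μ × IsInjectiveOnEdges _≼_ μ)
proposition2 n _≼_ po (σ , U) = refine σ , refine-U U , refine-injective σ
  where
  open EdgeCode po
  open TieBreaking _≼_ edgeCode edgeCode-injective
                   (λ x⋖z → ℕ.<⇒≤ (edgeCode-strict (proj₁ x⋖z)))
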